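{- Let $X=(X,\preceq,\delta)$ be a labeled poset, $r\in\mathbb N$, $Y\in X_r$ and $Y_1,Y_2\in\operatorname{Tot}(Y)$. Then $$T_{Y_1,Y_2}:\operatorname{Tot}_{Y_1}(X)\to\operatorname{Tot}_{Y_2}(X),\qquad \overline X\mapsto\big(X,(\preceq_{\overline X}\setminus\preceq_{Y_1})\cup\preceq_{Y_2},\delta\big),$$ is a well-defined bijection.
   Context: A labeled poset $X=(X,\preceq,\delta)$: finite set, partial order $\preceq$, labeling map $\delta$; subsets carry the restricted order. $\operatorname{Tot}(X)$: labeled posets $(X,\preceq',\delta)$ with $\preceq'$ a total order containing $\preceq$ (for $Y\subset X$, $\operatorname{Tot}(Y)$ refers to the induced order on $Y$); $\preceq_{\overline X}$, $\preceq_{Y_i}$ denote the orders (as subsets of $X\times X$). $X_r$ = set of $Y\subset X$ with $|Y|=r$ such that no $x\in X\setminus Y$ satisfies $y\preceq x\preceq y'$ for $y,y'\in Y$. For $Y\in X_r$ and $Z\in\operatorname{Tot}(Y)$, $\operatorname{Tot}_Z(X)$ is the set of $\overline X\in\operatorname{Tot}(X)$ such that $Y$ is convex in $\overline X$ (no element of $X\setminus Y$ lies between two elements of $Y$ in $\preceq_{\overline X}$) and $\preceq_Z\subset\preceq_{\overline X}$. -}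

module Defs where

open import Data.Nat using (ℕ)
open import Data.Bool using (Bool; true; false; T; _∧_; _∨_; not)
open import Data.Fin using (Fin)
open import Data.Fin.Subset using (Subset; _∈_; _∉_; ∣_∣)
open import Data.Product using (Σ; _×_; ∃-syntax)
open import Data.Sum using (_⊎_)
open import Relation.Nullary using (¬_)
open import Relation.Binary.PropositionalEquality using (_≡_)

BRel : ℕ → Set
BRel n = Fin n → Fin n → Bool

_⟨_⟩_ : ∀ {n} → Fin n → BRel n → Fin n → Set
x ⟨ R ⟩ y = T (R x y)

_⊆ᴿ_ : ∀ {n} → BRel n → BRel n → Set
R ⊆ᴿ S = ∀ x y → x ⟨ R ⟩ y → x ⟨ S ⟩ y

_≐_ : ∀ {n} → BRel n → BRel n → Set
R ≐ S = ∀ x y → R x y ≡ S x y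

_∖ᴿ_ : ∀ {n} → BRel n → BRel n → BRel n
(R ∖ᴿ S) x y = R x y ∧ not (S x y)

_∪ᴿ_ : ∀ {n} → BRel n → BRel n → BRel n
(R ∪ᴿ S) x y = R x y ∨ S x y

record IsPartialOrder {n} (R : BRel n) : Set where
  field
    refl    : ∀ x → x ⟨ R ⟩ x
    antisym : ∀ x y → x ⟨ R ⟩ y → y ⟨ R ⟩ x → x ≡ y
    trans   : ∀ x y z → x ⟨ R ⟩ y → y ⟨ R ⟩ z → x ⟨ R ⟩ z

record LabeledPoset (L : Set) : Set where
  field
    n      : ℕ
    ≼      : BRel n
    isPO   : IsPartialOrder ≼
    δ      : Fin n → L

InXr : ∀ {L} (X : LabeledPoset L) → ℕ → Subset (LabeledPoset.n X) → Set
InXr X r Y =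
  ∣ Y ∣ ≡ r ×
  (∀ x y y' → x ∉ Y → y ∈ Y → y' ∈ Y →
     ¬ (y ⟨ LabeledPoset.≼ X ⟩ x × x ⟨ LabeledPoset.≼ X ⟩ y'))

-- Z ∈ Tot(Y): a total order on Y (given as a subset of X × X, hence of
-- Y × Y) containing the order ≼ restricted to Y.
InTotSub : ∀ {L} (X : LabeledPoset L) → Subset (LabeledPoset.n X)
           → BRel (LabeledPoset.n X) → Set
InTotSub X Y Z =
  (∀ x y → x ⟨ Z ⟩ y → x ∈ Y × y ∈ Y) ×
  (∀ x → x ∈ Y → x ⟨ Z ⟩ x) ×
  (∀ x y → x ⟨ Z ⟩ y → y ⟨ Z ⟩ x → x ≡ y) ×
  (∀ x y z → x ⟨ Z ⟩ y → y ⟨ Z ⟩ z → x ⟨ Z ⟩ z) ×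
  (∀ x y → x ∈ Y → y ∈ Y → x ⟨ Z ⟩ y ⊎ y ⟨ Z ⟩ x) ×
  (∀ x y → x ∈ Y → y ∈ Y → x ⟨ LabeledPoset.≼ X ⟩ y → x ⟨ Z ⟩ y)

-- R ∈ Tot(X): a total order on X containing ≼ (same carrier and labeling)
InTot : ∀ {L} (X : LabeledPoset L) → BRel (LabeledPoset.n X) → Set
InTot X R = IsPartialOrder R × (∀ x y → x ⟨ R ⟩ y ⊎ y ⟨ R ⟩ x)
            × (LabeledPoset.≼ X ⊆ᴿ R)

Convex : ∀ {n} → BRel n → Subset n → Set
Convex R Y = ∀ x y y' → x ∉ Y → y ∈ Y → y' ∈ Y → ¬ (y ⟨ R ⟩ x × x ⟨ R ⟩ y')

InTotZ : ∀ {L} (X : LabeledPoset L) → Subset (LabeledPoset.n X)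
         → BRel (LabeledPoset.n X) → BRel (LabeledPoset.n X) → Set
InTotZ X Y Z R = InTot X R × Convex R Y × (Z ⊆ᴿ R)

Tmap : ∀ {n} → BRel n → BRel n → BRel n → BRel n
Tmap Y₁ Y₂ R = (R ∖ᴿ Y₁) ∪ᴿ Y₂

-- For an extension R of the order Y₁ on Y, R restricted to Y × Y is exactly Y₁
-- (a total order contained in a partial order on the same set equals it).  So
-- T_{Y₁,Y₂} leaves R unchanged off Y × Y and replaces its Y-block by Y₂.  Since
-- Y is convex in R, every element outside Y lies entirely below or entirely
-- above Y, so putting any total order on the block yields a total order again,
-- still with Y convex.  Applying the same description to T_{Y₂,Y₁} shows that
-- it is a two-sided inverse.
module Submission where

open import Defs
open import Data.Nat using (ℕ)
open import Data.Fin using (Fin)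
open import Data.Fin.Subset using (Subset; _∈_; _∉_)
open import Data.Fin.Subset.Properties using (_∈?_)
open import Data.Bool using (Bool; true; false; T; _∧_; _∨_; not)
open import Data.Bool.Properties using (∧-inverseʳ; ∧-identityʳ; ∨-identityʳ)
open import Data.Product using (_×_; _,_; Σ-syntax)
open import Data.Sum using (_⊎_; inj₁; inj₂; swap)
open import Data.Unit using (tt)
open import Data.Empty using (⊥-elim)
open import Relation.Nullary using (yes; no; contradiction)
open import Relation.Binary.PropositionalEquality
  using (_≡_; refl; sym; trans; cong; cong₂; subst)

T-ext : ∀ {a b : Bool} → (T a → T b) → (T b → T a) → a ≡ b
T-ext {false} {false} _   _   = refl
T-ext {false} {true}  _   b⇒a = ⊥-elim (b⇒a tt)
T-ext {true}  {false} a⇒b _   = ⊥-elim (a⇒b tt)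
T-ext {true}  {true}  _   _   = refl

≐-sym : ∀ {n} {R S : BRel n} → R ≐ S → S ≐ R
≐-sym R≐S x y = sym (R≐S x y)

≐-trans : ∀ {n} {R S U : BRel n} → R ≐ S → S ≐ U → R ≐ U
≐-trans R≐S S≐U x y = trans (R≐S x y) (S≐U x y)

Tmap-cong : ∀ {n} (Y₁ Y₂ : BRel n) {R R' : BRel n} → R ≐ R' → Tmap Y₁ Y₂ R ≐ Tmap Y₁ Y₂ R'
Tmap-cong Y₁ Y₂ R≐R' x y = cong (λ b → (b ∧ not (Y₁ x y)) ∨ Y₂ x y) (R≐R' x y)

module _ {n : ℕ} (Y : Subset n) where

  data Block (x y : Fin n) : Set where
    inner : x ∈ Y → y ∈ Y → Block x y
    outer : x ∉ Y ⊎ y ∉ Y → Block x y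

  block : ∀ x y → Block x y
  block x y with x ∈? Y | y ∈? Y
  ... | yes x∈Y | yes y∈Y = inner x∈Y y∈Y
  ... | no  x∉Y | _       = outer (inj₁ x∉Y)
  ... | yes _   | no  y∉Y = outer (inj₂ y∉Y)

  record IsBlockReplacement (R Z Q : BRel n) : Set where
    field
      on-block  : ∀ {x y} → x ∈ Y → y ∈ Y → Q x y ≡ Z x y
      off-block : ∀ {x y} → x ∉ Y ⊎ y ∉ Y → Q x y ≡ R x y

  open IsBlockReplacement

  blockReplacement-unique : ∀ {R Z Q Q'} → IsBlockReplacement R Z Q →
                            IsBlockReplacement R Z Q' → Q ≐ Q'
  blockReplacement-unique Q-rep Q'-rep x y with block x y
  ... | inner x∈Y y∈Y = trans (on-block Q-rep x∈Y y∈Y) (sym (on-block Q'-rep x∈Y y∈Y))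
  ... | outer off     = trans (off-block Q-rep off) (sym (off-block Q'-rep off))

  isBlockReplacement-refl : ∀ {R Z} → (∀ {x y} → x ∈ Y → y ∈ Y → R x y ≡ Z x y) →
                            IsBlockReplacement R Z R
  isBlockReplacement-refl R≡Z = record { on-block = R≡Z ; off-block = λ _ → refl }

  isBlockReplacement-trans : ∀ {R Z Z' S Q} → IsBlockReplacement R Z' S →
                             IsBlockReplacement S Z Q → IsBlockReplacement R Z Q
  isBlockReplacement-trans S-rep Q-rep = record
    { on-block  = on-block Q-rep
    ; off-block = λ off → trans (off-block Q-rep off) (off-block S-rep off)
    }

  module _ {R : BRel n} (R-total : ∀ x y → x ⟨ R ⟩ y ⊎ y ⟨ R ⟩ x)
           (Y-convex : Convex R Y) where

    above-one⇒above-all : ∀ {w a b} → w ∉ Y → a ∈ Y → b ∈ Y →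
                          a ⟨ R ⟩ w → b ⟨ R ⟩ w
    above-one⇒above-all {w} {a} {b} w∉Y a∈Y b∈Y aRw with R-total b w
    ... | inj₁ bRw = bRw
    ... | inj₂ wRb = contradiction (aRw , wRb) (Y-convex w a b w∉Y a∈Y b∈Y)

    below-one⇒below-all : ∀ {w a b} → w ∉ Y → a ∈ Y → b ∈ Y →
                          w ⟨ R ⟩ a → w ⟨ R ⟩ b
    below-one⇒below-all {w} {a} {b} w∉Y a∈Y b∈Y wRa with R-total w b
    ... | inj₁ wRb = wRb
    ... | inj₂ bRw = contradiction (bRw , wRa) (Y-convex w b a w∉Y b∈Y a∈Y)

module _ {L : Set} (X : LabeledPoset L) (Y : Subset (LabeledPoset.n X)) where
  open LabeledPoset X using (n; ≼)

  subOrder-off-block : ∀ {Z} → InTotSub X Y Z →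
                       ∀ {x y} → x ∉ Y ⊎ y ∉ Y → Z x y ≡ false
  subOrder-off-block {Z} (Z⊆Y×Y , _) {x} {y} off with Z x y in Zxy
  ... | false = refl
  ... | true with Z⊆Y×Y x y (subst T (sym Zxy) tt) | off
  ...   | x∈Y , _   | inj₁ x∉Y = contradiction x∈Y x∉Y
  ...   | _   , y∈Y | inj₂ y∉Y = contradiction y∈Y y∉Y

  extension-on-block : ∀ {Z R} → InTotSub X Y Z → IsPartialOrder R → Z ⊆ᴿ R →
                       ∀ {x y} → x ∈ Y → y ∈ Y → R x y ≡ Z x y
  extension-on-block {Z} {R} (_ , Z-refl , _ , _ , Z-total , _) R-po Z⊆R {x} {y} x∈Y y∈Y =
    T-ext R⇒Z (Z⊆R x y)
    where
      R⇒Z : x ⟨ R ⟩ y → x ⟨ Z ⟩ y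
      R⇒Z xRy with Z-total x y x∈Y y∈Y
      ... | inj₁ xZy = xZy
      ... | inj₂ yZx with IsPartialOrder.antisym R-po x y xRy (Z⊆R y x yZx)
      ...   | refl = Z-refl x x∈Y

  Tmap-isBlockReplacement : ∀ {Y₁ Y₂ R} → InTotSub X Y Y₁ → InTotSub X Y Y₂ →
                            InTotZ X Y Y₁ R → IsBlockReplacement Y R Y₂ (Tmap Y₁ Y₂ R)
  Tmap-isBlockReplacement {Y₁} {Y₂} {R} Y₁-tot Y₂-tot ((R-po , _) , _ , Y₁⊆R) = record
    { on-block  = λ {x} {y} x∈Y y∈Y → trans
        (cong (λ b → (b ∧ not (Y₁ x y)) ∨ Y₂ x y)
              (extension-on-block Y₁-tot R-po Y₁⊆R x∈Y y∈Y))
        (cong (_∨ Y₂ x y) (∧-inverseʳ (Y₁ x y)))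
    ; off-block = λ {x} {y} off → trans
        (cong₂ (λ b c → (R x y ∧ not b) ∨ c)
               (subOrder-off-block Y₁-tot off) (subOrder-off-block Y₂-tot off))
        (trans (∨-identityʳ _) (∧-identityʳ (R x y)))
    }

  module BlockReplacementOrder
    {Z R Q : BRel n}
    (Z-refl    : ∀ x → x ∈ Y → x ⟨ Z ⟩ x)
    (Z-antisym : ∀ x y → x ⟨ Z ⟩ y → y ⟨ Z ⟩ x → x ≡ y)
    (Z-trans   : ∀ x y z → x ⟨ Z ⟩ y → y ⟨ Z ⟩ z → x ⟨ Z ⟩ z)
    (Z-total   : ∀ x y → x ∈ Y → y ∈ Y → x ⟨ Z ⟩ y ⊎ y ⟨ Z ⟩ x)
    (R-po      : IsPartialOrder R)
    (R-total   : ∀ x y → x ⟨ R ⟩ y ⊎ y ⟨ R ⟩ x)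
    (Y-convex  : Convex R Y)
    (Q-rep     : IsBlockReplacement Y R Z Q)
    where

    open IsBlockReplacement Q-rep
    open IsPartialOrder R-po renaming (refl to R-refl; antisym to R-antisym; trans to R-trans)

    Q⇒Z : ∀ {x y} → x ∈ Y → y ∈ Y → x ⟨ Q ⟩ y → x ⟨ Z ⟩ y
    Q⇒Z x∈Y y∈Y = subst T (on-block x∈Y y∈Y)

    Z⇒Q : ∀ {x y} → x ∈ Y → y ∈ Y → x ⟨ Z ⟩ y → x ⟨ Q ⟩ y
    Z⇒Q x∈Y y∈Y = subst T (sym (on-block x∈Y y∈Y))

    Q⇒R : ∀ {x y} → x ∉ Y ⊎ y ∉ Y → x ⟨ Q ⟩ y → x ⟨ R ⟩ y
    Q⇒R off = subst T (off-block off)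

    R⇒Q : ∀ {x y} → x ∉ Y ⊎ y ∉ Y → x ⟨ R ⟩ y → x ⟨ Q ⟩ y
    R⇒Q off = subst T (sym (off-block off))

    Q-refl : ∀ x → x ⟨ Q ⟩ x
    Q-refl x with x ∈? Y
    ... | yes x∈Y = Z⇒Q x∈Y x∈Y (Z-refl x x∈Y)
    ... | no  x∉Y = R⇒Q (inj₁ x∉Y) (R-refl x)

    Q-antisym : ∀ x y → x ⟨ Q ⟩ y → y ⟨ Q ⟩ x → x ≡ y
    Q-antisym x y xQy yQx with block Y x y
    ... | inner x∈Y y∈Y     = Z-antisym x y (Q⇒Z x∈Y y∈Y xQy) (Q⇒Z y∈Y x∈Y yQx)
    ... | outer (inj₁ x∉Y) = R-antisym x y (Q⇒R (inj₁ x∉Y) xQy) (Q⇒R (inj₂ x∉Y) yQx)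
    ... | outer (inj₂ y∉Y) = R-antisym x y (Q⇒R (inj₂ y∉Y) xQy) (Q⇒R (inj₁ y∉Y) yQx)

    Q-total : ∀ x y → x ⟨ Q ⟩ y ⊎ y ⟨ Q ⟩ x
    Q-total x y with block Y x y
    ... | inner x∈Y y∈Y with Z-total x y x∈Y y∈Y
    ...   | inj₁ xZy = inj₁ (Z⇒Q x∈Y y∈Y xZy)
    ...   | inj₂ yZx = inj₂ (Z⇒Q y∈Y x∈Y yZx)
    Q-total x y | outer off with R-total x y
    ...   | inj₁ xRy = inj₁ (R⇒Q off xRy)
    ...   | inj₂ yRx = inj₂ (R⇒Q (swap off) yRx)

    -- A point y ∉ Y between x, z ∈ Y contradicts convexity; every other mixed
    -- case is settled in R, moving the outside point past the whole block.
    Q-trans : ∀ x y z → x ⟨ Q ⟩ y → y ⟨ Q ⟩ z → x ⟨ Q ⟩ z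
    Q-trans x y z xQy yQz with x ∈? Y | y ∈? Y | z ∈? Y
    ... | yes x∈Y | yes y∈Y | yes z∈Y =
      Z⇒Q x∈Y z∈Y (Z-trans x y z (Q⇒Z x∈Y y∈Y xQy) (Q⇒Z y∈Y z∈Y yQz))
    ... | yes x∈Y | no y∉Y | yes z∈Y =
      contradiction (Q⇒R (inj₂ y∉Y) xQy , Q⇒R (inj₁ y∉Y) yQz) (Y-convex y x z y∉Y x∈Y z∈Y)
    ... | yes x∈Y | yes y∈Y | no z∉Y =
      R⇒Q (inj₂ z∉Y) (above-one⇒above-all Y R-total Y-convex z∉Y y∈Y x∈Y (Q⇒R (inj₂ z∉Y) yQz))
    ... | no x∉Y | yes y∈Y | yes z∈Y =
      R⇒Q (inj₁ x∉Y) (below-one⇒below-all Y R-total Y-convex x∉Y y∈Y z∈Y (Q⇒R (inj₁ x∉Y) xQy))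
    ... | yes _ | no y∉Y | no z∉Y =
      R⇒Q (inj₂ z∉Y) (R-trans x y z (Q⇒R (inj₂ y∉Y) xQy) (Q⇒R (inj₁ y∉Y) yQz))
    ... | no x∉Y | yes _ | no z∉Y =
      R⇒Q (inj₁ x∉Y) (R-trans x y z (Q⇒R (inj₁ x∉Y) xQy) (Q⇒R (inj₂ z∉Y) yQz))
    ... | no x∉Y | no y∉Y | _ =
      R⇒Q (inj₁ x∉Y) (R-trans x y z (Q⇒R (inj₁ x∉Y) xQy) (Q⇒R (inj₁ y∉Y) yQz))

    Q-convex : Convex Q Y
    Q-convex x y y' x∉Y y∈Y y'∈Y (yQx , xQy') =
      Y-convex x y y' x∉Y y∈Y y'∈Y (Q⇒R (inj₂ x∉Y) yQx , Q⇒R (inj₁ x∉Y) xQy')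

  blockReplacement-InTotZ : ∀ {Z R Q} → InTotSub X Y Z → InTot X R → Convex R Y →
                            IsBlockReplacement Y R Z Q → InTotZ X Y Z Q
  blockReplacement-InTotZ {Z} {R} {Q}
    (Z⊆Y×Y , Z-refl , Z-antisym , Z-trans , Z-total , ≼⊆Z) (R-po , R-total , ≼⊆R) Y-convex Q-rep =
    (Q-po , Q-total , ≼⊆Q) , Q-convex , Z⊆Q
    where
      open BlockReplacementOrder Z-refl Z-antisym Z-trans Z-total R-po R-total Y-convex Q-rep

      Q-po : IsPartialOrder Q
      Q-po = record { refl = Q-refl ; antisym = Q-antisym ; trans = Q-trans }

      ≼⊆Q : ≼ ⊆ᴿ Q
      ≼⊆Q x y x≼y with block Y x y
      ... | inner x∈Y y∈Y = Z⇒Q x∈Y y∈Y (≼⊆Z x y x∈Y y∈Y x≼y)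
      ... | outer off     = R⇒Q off (≼⊆R x y x≼y)

      Z⊆Q : Z ⊆ᴿ Q
      Z⊆Q x y xZy with Z⊆Y×Y x y xZy
      ... | x∈Y , y∈Y = Z⇒Q x∈Y y∈Y xZy

  Tmap-InTotZ : ∀ {Y₁ Y₂ R} → InTotSub X Y Y₁ → InTotSub X Y Y₂ →
                InTotZ X Y Y₁ R → InTotZ X Y Y₂ (Tmap Y₁ Y₂ R)
  Tmap-InTotZ Y₁-tot Y₂-tot R∈@(R-tot , Y-convex , _) =
    blockReplacement-InTotZ Y₂-tot R-tot Y-convex (Tmap-isBlockReplacement Y₁-tot Y₂-tot R∈)

  Tmap-inverseˡ : ∀ {Y₁ Y₂ R} → InTotSub X Y Y₁ → InTotSub X Y Y₂ →
                  InTotZ X Y Y₁ R → Tmap Y₂ Y₁ (Tmap Y₁ Y₂ R) ≐ R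
  Tmap-inverseˡ Y₁-tot Y₂-tot R∈@((R-po , _) , _ , Y₁⊆R) =
    blockReplacement-unique Y
      (isBlockReplacement-trans Y (Tmap-isBlockReplacement Y₁-tot Y₂-tot R∈)
        (Tmap-isBlockReplacement Y₂-tot Y₁-tot (Tmap-InTotZ Y₁-tot Y₂-tot R∈)))
      (isBlockReplacement-refl Y (extension-on-block Y₁-tot R-po Y₁⊆R))

lemma3 : {L : Set} (X : LabeledPoset L) (r : ℕ) (Y : Subset (LabeledPoset.n X))
    → InXr X r Y
    → (Y₁ Y₂ : BRel (LabeledPoset.n X))
    → InTotSub X Y Y₁ → InTotSub X Y Y₂
    → ((R : BRel (LabeledPoset.n X)) → InTotZ X Y Y₁ R → InTotZ X Y Y₂ (Tmap Y₁ Y₂ R))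
      × ((R R' : BRel (LabeledPoset.n X)) → InTotZ X Y Y₁ R → InTotZ X Y Y₁ R'
           → Tmap Y₁ Y₂ R ≐ Tmap Y₁ Y₂ R' → R ≐ R')
      × ((S : BRel (LabeledPoset.n X)) → InTotZ X Y Y₂ S
           → Σ[ R ∈ BRel (LabeledPoset.n X) ] (InTotZ X Y Y₁ R × Tmap Y₁ Y₂ R ≐ S))
lemma3 X r Y _ Y₁ Y₂ Y₁-tot Y₂-tot =
    (λ R → Tmap-InTotZ X Y Y₁-tot Y₂-tot)
  , (λ R R' R∈ R'∈ TR≐TR' →
       ≐-trans (≐-sym (Tmap-inverseˡ X Y Y₁-tot Y₂-tot R∈))
         (≐-trans (Tmap-cong Y₂ Y₁ TR≐TR') (Tmap-inverseˡ X Y Y₁-tot Y₂-tot R'∈)))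
  , (λ S S∈ → Tmap Y₂ Y₁ S , Tmap-InTotZ X Y Y₂-tot Y₁-tot S∈ , Tmap-inverseˡ X Y Y₂-tot Y₁-tot S∈)
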